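{- For every Boolean function $f:\{0,1\}^n\to\{0,1\}$ there exists $f':\{0,1\}^n\to\{0,1\}$ such that $\mathrm{s}(f')=\mathrm{s}(f)$, $\mathrm{bs}(f')=\mathrm{bs}(f)=\mathrm{bs}(f',0^n)$, and $f'$ has a DNF representation in normalized compact form.
   Context: For $x\in\{0,1\}^n$, $x^i$ flips bit $i$ and $x^B$ flips the bits in $B\subseteq[n]$. $\mathrm{s}(f,x)=|\{i: f(x)\ne f(x^i)\}|$, $\mathrm{s}(f)=\max_x\mathrm{s}(f,x)$. $\mathrm{bs}(f,x)$ is the maximum $k$ such that there are pairwise disjoint $B_1,\dots,B_k\subseteq[n]$ with $f(x^{B_j})\ne f(x)$ for all $j$; $\mathrm{bs}(f)=\max_x\mathrm{bs}(f,x)$, $\mathrm{bs}_0(f)=\max_{f(x)=0}\mathrm{bs}(f,x)$. A DNF representation of $f$ is an OR of terms $\wedge_1,\dots,\wedge_{d_\vee}$, each an AND of literals with no term containing a variable and its negation; $S_i$ is the set of assignments satisfying $\wedge_i$. It is in compact form if (a) $f(0^n)=0$, (b) $\mathrm{bs}_0(f)=\mathrm{bs}(f,0^n)$, (c) $S_i\setminus\bigcup_{j\ne i}S_j\ne\emptyset$ for every $i$; it is normalized if moreover $\mathrm{bs}(f)=\mathrm{bs}(f,0^n)$. -}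

module Defs where

open import Data.Bool using (Bool; true; false; not; _xor_; if_then_else_)
open import Data.Nat using (ℕ; zero; suc; _+_; _≤_)
open import Data.Fin using (Fin)
open import Data.Vec using (Vec; lookup; replicate; zipWith; _[_]%=_)
open import Data.List using (List; length; map; allFin)
open import Data.Bool.ListAction using (any; all)
import Data.List
open import Data.Nat.ListAction using (sum)
open import Data.List.Membership.Propositional using (_∈_)
open import Data.Product using (Σ; ∃; _×_; _,_)
open import Relation.Binary.PropositionalEquality using (_≡_; _≢_)
open import Relation.Nullary using (¬_)

-- Inputs {0,1}^n as bit vectors (true = 1).
Input : ℕ → Set
Input n = Vec Bool n

BoolFun : ℕ → Set
BoolFun n = Input n → Bool

zeros : (n : ℕ) → Input n
zeros n = replicate n false

flipBit : ∀ {n} → Input n → Fin n → Input n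
flipBit x i = x [ i ]%= not

-- A block B ⊆ [n] as a characteristic vector; x^B flips the bits in B
Block : ℕ → Set
Block n = Vec Bool n

flipBlock : ∀ {n} → Input n → Block n → Input n
flipBlock x B = zipWith _xor_ x B

sensAt : ∀ {n} → BoolFun n → Input n → ℕ
sensAt {n} f x = sum (map (λ i → if f x xor f (flipBit x i) then 1 else 0) (allFin n))

IsSens : ∀ {n} → BoolFun n → ℕ → Set
IsSens f k = (∃ λ x → sensAt f x ≡ k) × (∀ x → sensAt f x ≤ k)

Disjoint : ∀ {n} → Block n → Block n → Set
Disjoint {n} B C = ∀ (i : Fin n) → lookup B i ≡ true → lookup C i ≡ false

HasSensBlocks : ∀ {n} → BoolFun n → Input n → ℕ → Set
HasSensBlocks {n} f x k =
  Σ (Vec (Block n) k) λ Bs →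
    (∀ (j j' : Fin k) → j ≢ j' → Disjoint (lookup Bs j) (lookup Bs j')) ×
    (∀ (j : Fin k) → f (flipBlock x (lookup Bs j)) ≢ f x)

IsBSAt : ∀ {n} → BoolFun n → Input n → ℕ → Set
IsBSAt f x k = HasSensBlocks f x k × (∀ m → HasSensBlocks f x m → m ≤ k)

IsBS : ∀ {n} → BoolFun n → ℕ → Set
IsBS f k = (∃ λ x → HasSensBlocks f x k) × (∀ x m → HasSensBlocks f x m → m ≤ k)

IsBS0 : ∀ {n} → BoolFun n → ℕ → Set
IsBS0 f k = (∃ λ x → f x ≡ false × HasSensBlocks f x k)
          × (∀ x m → f x ≡ false → HasSensBlocks f x m → m ≤ k)

Literal : ℕ → Set
Literal n = Fin n × Bool

record Term (n : ℕ) : Set where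
  constructor term
  field
    lits       : List (Literal n)
    consistent : ∀ (i : Fin n) → ¬ ((i , true) ∈ lits × (i , false) ∈ lits)
open Term public

litHolds : ∀ {n} → Input n → Literal n → Bool
litHolds x (i , true)  = lookup x i
litHolds x (i , false) = not (lookup x i)

satTerm : ∀ {n} → Term n → Input n → Bool
satTerm t x = all (litHolds x) (lits t)

DNF : ℕ → Set
DNF n = List (Term n)

evalDNF : ∀ {n} → DNF n → Input n → Bool
evalDNF D x = any (λ t → satTerm t x) D

Represents : ∀ {n} → DNF n → BoolFun n → Set
Represents D f = ∀ x → evalDNF D x ≡ f x

UniquelySatisfiable : ∀ {n} → DNF n → Set
UniquelySatisfiable {n} D =
  ∀ (i : Fin (length D)) → ∃ λ (x : Input n) →
    satTerm (Data.List.lookup D i) x ≡ true ×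
    (∀ (j : Fin (length D)) → j ≢ i → satTerm (Data.List.lookup D j) x ≡ false)

CompactForm : ∀ {n} → BoolFun n → DNF n → Set
CompactForm {n} f D =
  Represents D f ×
  f (zeros n) ≡ false ×
  (∃ λ k → IsBS0 f k × IsBSAt f (zeros n) k) ×
  UniquelySatisfiable D

NormalizedCompactForm : ∀ {n} → BoolFun n → DNF n → Set
NormalizedCompactForm {n} f D =
  CompactForm f D × (∃ λ k → IsBS f k × IsBSAt f (zeros n) k)

-- Translating f to f' y = f (y ⊕ c) ⊕ f c, where c is an input of maximal block sensitivity,
-- moves c to 0ⁿ and makes f' vanish there. Translation by c is a bijection of the cube that
-- commutes with single-bit and block flips, so it preserves s(·,x) and bs(·,x) up to moving x;
-- hence bs(f') = bs(f) = bs(f', 0ⁿ), and since f'(0ⁿ) = 0 also bs₀(f') = bs(f', 0ⁿ).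
-- The DNF of minterms of the true points of f' is compact, as distinct minterms are never
-- satisfied together.
module Submission where

open import Defs
open import Data.Nat using (ℕ; zero; suc; _≤_; s≤s⁻¹)
open import Data.Product using (∃; _×_; _,_; proj₁; proj₂)

open import Data.Bool using (Bool; true; false; not; _xor_; if_then_else_; T)
open import Data.Bool.Properties as Bool
  using ( xor-same; xor-identityʳ; xor-inverseˡ; xor-inverseʳ; xor-assoc; xor-comm
        ; not-distribˡ-xor; T-≡; T-not-≡; ¬-not )
open import Data.Nat.Properties using (≤∧≢⇒<)
open import Data.Fin using (Fin)
import Data.Fin.Properties as Finₚ
open import Data.Fin.Subset using (Nonempty; ⊥)
open import Data.Fin.Subset.Properties using (nonempty?; Empty-unique)
open import Data.Vec using (Vec; lookup)
open import Data.Vec.Properties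
  using ( zipWith-assoc; zipWith-comm; zipWith-identityˡ; zipWith-identityʳ
        ; ∷-injective; []=⇒lookup )
open import Data.Vec.Relation.Binary.Pointwise.Extensional using (ext; Pointwise-≡⇒≡)
open import Data.List as List using (List; []; _∷_; map; allFin; filter; cartesianProductWith)
open import Data.List.Properties using (map-cong)
open import Data.Nat.ListAction using (sum)
open import Data.List.Extrema.Nat using (argmax; f[xs]≤f[argmax])
open import Data.List.Membership.Propositional using (_∈_; _∉_)
open import Data.List.Membership.Propositional.Properties
  using ( ∈-allFin; ∈-map⁺; ∈-map⁻; ∈-filter⁺; ∈-filter⁻; ∈-lookup
        ; ∈-cartesianProductWith⁺ )
open import Data.List.Relation.Unary.Any as Any using (here; there; satisfied)
open import Data.List.Relation.Unary.Any.Properties as Anyₚ using (any⁺; any⁻)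
import Data.List.Relation.Unary.All as All
open import Data.List.Relation.Unary.All.Properties using (all⁺; all⁻)
import Data.List.Relation.Unary.AllPairs as AllPairs
open import Data.List.Relation.Unary.Unique.Propositional using (Unique)
open import Data.List.Relation.Unary.Unique.Propositional.Properties as Unique
  using (Unique[x∷xs]⇒x∉xs)
open import Function using (_∘_; _⇔_; mk⇔; Equivalence)
open Equivalence using (to; from)
open import Level using (Level)
open import Relation.Nullary using (Dec; yes; no; contradiction)
open import Relation.Nullary.Decidable using (_×-dec_; _→-dec_; ¬?)
open import Relation.Unary using (Pred; Decidable)
open import Relation.Binary.PropositionalEquality
  using (_≡_; _≢_; refl; sym; trans; cong; cong₂; subst; module ≡-Reasoning)

private
  variable
    ℓ : Level
    n m : ℕ

xor-cancelʳ : ∀ {a b} k → a xor k ≡ b xor k → a ≡ b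
xor-cancelʳ {a} {b} k e = begin
  a                ≡⟨ sym (xor-cancel-self a k) ⟩
  (a xor k) xor k  ≡⟨ cong (_xor k) e ⟩
  (b xor k) xor k  ≡⟨ xor-cancel-self b k ⟩
  b                ∎
  where
  open ≡-Reasoning
  xor-cancel-self : ∀ x k → (x xor k) xor k ≡ x
  xor-cancel-self x k =
    trans (xor-assoc x k k) (trans (cong (x xor_) (xor-same k)) (xor-identityʳ x))

xor-cancel-common : ∀ a b k → (a xor k) xor (b xor k) ≡ a xor b
xor-cancel-common false false k = xor-same k
xor-cancel-common false true  k = xor-inverseʳ k
xor-cancel-common true  false k = xor-inverseˡ k
xor-cancel-common true  true  k = xor-same (not k)

flipBlock-zeros : (c : Block n) → flipBlock (zeros n) c ≡ c
flipBlock-zeros = zipWith-identityˡ (λ _ → refl)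

flipBlock-⊥ : (x : Input n) → flipBlock x ⊥ ≡ x
flipBlock-⊥ = zipWith-identityʳ xor-identityʳ

flipBlock-self : (c : Block n) → flipBlock c c ≡ ⊥
flipBlock-self Vec.[]       = refl
flipBlock-self (b Vec.∷ c) = cong₂ Vec._∷_ (xor-same b) (flipBlock-self c)

flipBlock-involutive : (x : Input n) (c : Block n) → flipBlock (flipBlock x c) c ≡ x
flipBlock-involutive x c = begin
  flipBlock (flipBlock x c) c  ≡⟨ zipWith-assoc xor-assoc x c c ⟩
  flipBlock x (flipBlock c c)  ≡⟨ cong (flipBlock x) (flipBlock-self c) ⟩
  flipBlock x ⊥                ≡⟨ flipBlock-⊥ x ⟩
  x                            ∎
  where open ≡-Reasoning

flipBlock-swap : (x : Input n) (B c : Block n) →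
                 flipBlock (flipBlock x B) c ≡ flipBlock (flipBlock x c) B
flipBlock-swap x B c = begin
  flipBlock (flipBlock x B) c  ≡⟨ zipWith-assoc xor-assoc x B c ⟩
  flipBlock x (flipBlock B c)  ≡⟨ cong (flipBlock x) (zipWith-comm xor-comm B c) ⟩
  flipBlock x (flipBlock c B)  ≡⟨ zipWith-assoc xor-assoc x c B ⟨
  flipBlock (flipBlock x c) B  ∎
  where open ≡-Reasoning

flipBlock-flipBit : (x : Input n) (c : Block n) (i : Fin n) →
                    flipBlock (flipBit x i) c ≡ flipBit (flipBlock x c) i
flipBlock-flipBit (a Vec.∷ _) (b Vec.∷ _) Fin.zero    =
  cong (Vec._∷ _) (sym (not-distribˡ-xor a b))
flipBlock-flipBit (_ Vec.∷ x) (_ Vec.∷ c) (Fin.suc i) =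
  cong (_ Vec.∷_) (flipBlock-flipBit x c i)

vectors : {A : Set} → List A → (m : ℕ) → List (Vec A m)
vectors xs zero    = Vec.[] ∷ []
vectors xs (suc m) = cartesianProductWith Vec._∷_ xs (vectors xs m)

∈-vectors : {A : Set} {xs : List A} → (∀ a → a ∈ xs) →
            (v : Vec A m) → v ∈ vectors xs m
∈-vectors complete Vec.[]      = here refl
∈-vectors complete (a Vec.∷ v) =
  ∈-cartesianProductWith⁺ Vec._∷_ (complete a) (∈-vectors complete v)

vectors-unique : {A : Set} {xs : List A} → Unique xs → ∀ m → Unique (vectors xs m)
vectors-unique u zero    = All.[] AllPairs.∷ AllPairs.[]
vectors-unique u (suc m) =
  Unique.cartesianProductWith⁺ Vec._∷_ ∷-injective u (vectors-unique u m)

booleans : List Bool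
booleans = true ∷ false ∷ []

∈-booleans : ∀ b → b ∈ booleans
∈-booleans true  = here refl
∈-booleans false = there (here refl)

booleans-unique : Unique booleans
booleans-unique = ((λ ()) All.∷ All.[]) AllPairs.∷ (All.[] AllPairs.∷ AllPairs.[])

inputs : (n : ℕ) → List (Input n)
inputs = vectors booleans

∈-inputs : (x : Input n) → x ∈ inputs n
∈-inputs = ∈-vectors ∈-booleans

∃?-enumerated : {A : Set} {P : Pred A ℓ} (xs : List A) → (∀ a → a ∈ xs) →
                Decidable P → Dec (∃ P)
∃?-enumerated xs complete P? with Any.any? P? xs
... | yes p = yes (satisfied p)
... | no ¬p = no λ (a , pa) → ¬p (Any.map (λ { refl → pa }) (complete a))

greatest : {P : Pred ℕ ℓ} → Decidable P → P 0 →
           ∀ k → ∃ λ b → P b × (∀ {m} → m ≤ k → P m → m ≤ b)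
greatest P? p0 zero = 0 , p0 , λ m≤0 _ → m≤0
greatest P? p0 (suc k) with P? (suc k)
... | yes pk = suc k , pk , λ m≤1+k _ → m≤1+k
... | no ¬pk with greatest P? p0 k
...   | b , pb , below = b , pb , λ m≤1+k pm →
          below (s≤s⁻¹ (≤∧≢⇒< m≤1+k λ { refl → ¬pk pm })) pm

sensitivity : (f : BoolFun n) → ∃ (IsSens f)
sensitivity {n} f =
  sensAt f a , (a , refl) ,
  λ x → All.lookup (f[xs]≤f[argmax] (zeros n) (inputs n)) (∈-inputs x)
  where a = argmax (sensAt f) (zeros n) (inputs n)

disjoint? : (B C : Block n) → Dec (Disjoint B C)
disjoint? B C = Finₚ.all? λ i → (lookup B i Bool.≟ true) →-dec (lookup C i Bool.≟ false)

hasSensBlocks? : (f : BoolFun n) (x : Input n) (m : ℕ) → Dec (HasSensBlocks f x m)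
hasSensBlocks? {n} f x m = ∃?-enumerated (vectors (inputs n) m) (∈-vectors ∈-inputs) λ Bs →
  Finₚ.all? (λ j → Finₚ.all? λ j' →
    ¬? (j Finₚ.≟ j') →-dec disjoint? (lookup Bs j) (lookup Bs j'))
  ×-dec Finₚ.all? (λ j → ¬? (f (flipBlock x (lookup Bs j)) Bool.≟ f x))

-- Blocks are subsets in the sense of Data.Fin.Subset, where inside = true.
sensitive-block-nonempty : (f : BoolFun n) (x : Input n) {B : Block n} →
                           f (flipBlock x B) ≢ f x → Nonempty B
sensitive-block-nonempty f x {B} sensitive with nonempty? B
... | yes nonempty = nonempty
... | no empty     = contradiction (cong f flip-empty) sensitive
  where
  flip-empty : flipBlock x B ≡ x
  flip-empty = trans (cong (flipBlock x) (Empty-unique empty)) (flipBlock-⊥ x)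

hasSensBlocks⇒≤ : (f : BoolFun n) (x : Input n) → HasSensBlocks f x m → m ≤ n
hasSensBlocks⇒≤ {n} {m} f x (Bs , disjoint , sensitive) = Finₚ.injective⇒≤ pick-injective
  where
  pick : Fin m → Fin n
  pick j = proj₁ (sensitive-block-nonempty f x (sensitive j))
  pick-∈ : ∀ j → lookup (lookup Bs j) (pick j) ≡ true
  pick-∈ j = []=⇒lookup (proj₂ (sensitive-block-nonempty f x (sensitive j)))
  pick-injective : ∀ {j j'} → pick j ≡ pick j' → j ≡ j'
  pick-injective {j} {j'} e with j Finₚ.≟ j'
  ... | yes j≡j' = j≡j'
  ... | no j≢j'  = contradiction (trans (sym (pick-∈ j')) outside) λ ()
    where
    outside : lookup (lookup Bs j') (pick j') ≡ false
    outside = subst (λ i → lookup (lookup Bs j') i ≡ false) e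
                (disjoint j j' j≢j' (pick j) (pick-∈ j))

blockSensitivity : (f : BoolFun n) → ∃ (IsBS f)
blockSensitivity {n} f =
  let b , attained , below = greatest attained? (zeros n , noBlocks) n
  in  b , attained , λ x m hsb → below (hasSensBlocks⇒≤ f x hsb) (x , hsb)
  where
  noBlocks : HasSensBlocks f (zeros n) 0
  noBlocks = Vec.[] , (λ ()) , (λ ())
  attained? : Decidable (λ m → ∃ λ x → HasSensBlocks f x m)
  attained? m = ∃?-enumerated (inputs n) ∈-inputs λ x → hasSensBlocks? f x m

translate : BoolFun n → Input n → BoolFun n
translate f c y = f (flipBlock y c) xor f c

translate-zeros : (f : BoolFun n) (c : Input n) → translate f c (zeros n) ≡ false
translate-zeros f c = trans (cong (λ z → f z xor f c) (flipBlock-zeros c)) (xor-same (f c))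

translate-≡ : (f : BoolFun n) (c y z : Input n) →
              translate f c y ≡ translate f c z ⇔ f (flipBlock y c) ≡ f (flipBlock z c)
translate-≡ f c y z = mk⇔ (xor-cancelʳ (f c)) (cong (_xor f c))

sensAt-translate : (f : BoolFun n) (c y : Input n) →
                   sensAt (translate f c) y ≡ sensAt f (flipBlock y c)
sensAt-translate {n} f c y =
  cong sum (map-cong (cong (λ b → if b then 1 else 0) ∘ edge) (allFin n))
  where
  open ≡-Reasoning
  edge : ∀ i → translate f c y xor translate f c (flipBit y i)
             ≡ f (flipBlock y c) xor f (flipBit (flipBlock y c) i)
  edge i = begin
    translate f c y xor translate f c (flipBit y i)
      ≡⟨ xor-cancel-common (f (flipBlock y c)) _ (f c) ⟩
    f (flipBlock y c) xor f (flipBlock (flipBit y i) c)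
      ≡⟨ cong (λ z → f (flipBlock y c) xor f z) (flipBlock-flipBit y c i) ⟩
    f (flipBlock y c) xor f (flipBit (flipBlock y c) i)
      ∎

hasSensBlocks-translate : (f : BoolFun n) (c y : Input n) →
                          HasSensBlocks (translate f c) y m ⇔ HasSensBlocks f (flipBlock y c) m
hasSensBlocks-translate f c y = mk⇔
  (λ (Bs , disjoint , sensitive) → Bs , disjoint , λ j →
     sensitive j ∘ from (translate-≡ f c _ y) ∘ trans (swap (lookup Bs j)))
  (λ (Bs , disjoint , sensitive) → Bs , disjoint , λ j →
     sensitive j ∘ trans (sym (swap (lookup Bs j))) ∘ to (translate-≡ f c _ y))
  where
  swap : ∀ B → f (flipBlock (flipBlock y B) c) ≡ f (flipBlock (flipBlock y c) B)
  swap B = cong f (flipBlock-swap y B c)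

translate-centre : (f : BoolFun n) (c : Input n) →
                   HasSensBlocks f c m → HasSensBlocks (translate f c) (zeros n) m
translate-centre {n} {m} f c =
  from (hasSensBlocks-translate f c (zeros n))
  ∘ subst (λ z → HasSensBlocks f z m) (sym (flipBlock-zeros c))

IsSens-translate : (f : BoolFun n) (c : Input n) {s : ℕ} →
                   IsSens f s → IsSens (translate f c) s
IsSens-translate f c {s} ((a , sens-a) , below) =
  (flipBlock a c , trans (sensAt-translate f c _)
                         (trans (cong (sensAt f) (flipBlock-involutive a c)) sens-a)) ,
  λ y → subst (_≤ s) (sym (sensAt-translate f c y)) (below (flipBlock y c))

IsBS-translate : (f : BoolFun n) (c : Input n) {b : ℕ} → IsBS f b → IsBS (translate f c) b
IsBS-translate f c {b} ((x , hsb) , below) =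
  (flipBlock x c , from (hasSensBlocks-translate f c _)
                     (subst (λ z → HasSensBlocks f z b) (sym (flipBlock-involutive x c)) hsb)) ,
  λ y m → below (flipBlock y c) m ∘ to (hasSensBlocks-translate f c y)

IsBS⇒IsBSAt : {f : BoolFun n} {b : ℕ} {x : Input n} →
              IsBS f b → HasSensBlocks f x b → IsBSAt f x b
IsBS⇒IsBSAt {x = x} (_ , below) hsb = hsb , below x

IsBS⇒IsBS0 : {f : BoolFun n} {b : ℕ} {x : Input n} →
             IsBS f b → f x ≡ false → HasSensBlocks f x b → IsBS0 f b
IsBS⇒IsBS0 {x = x} (_ , below) fx≡0 hsb = (x , fx≡0 , hsb) , λ y m _ → below y m

mintermLits : Input n → List (Literal n)
mintermLits {n} q = map (λ i → i , lookup q i) (allFin n)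

∈-mintermLits⁻ : (q : Input n) {i : Fin n} {b : Bool} →
                 (i , b) ∈ mintermLits q → lookup q i ≡ b
∈-mintermLits⁻ q mem with ∈-map⁻ (λ i → i , lookup q i) mem
... | _ , _ , refl = refl

minterm : Input n → Term n
minterm q = term (mintermLits q) λ i (positive , negative) →
  contradiction (trans (sym (∈-mintermLits⁻ q positive)) (∈-mintermLits⁻ q negative)) λ ()

T-litHolds : (x : Input n) (i : Fin n) (b : Bool) → T (litHolds x (i , b)) ⇔ lookup x i ≡ b
T-litHolds x i true  = T-≡
T-litHolds x i false = T-not-≡

satTerm-minterm : (q x : Input n) → satTerm (minterm q) x ≡ true ⇔ x ≡ q
satTerm-minterm q x = mk⇔
  (λ sat → Pointwise-≡⇒≡ (ext λ i → to (T-litHolds x i _)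
     (All.lookup (all⁺ _ _ (from T-≡ sat)) (∈-map⁺ _ (∈-allFin i)))))
  (λ { refl → to T-≡ (all⁻ (litHolds q) {mintermLits q} (All.tabulate λ {(i , b)} mem →
     from (T-litHolds q i b) (∈-mintermLits⁻ q mem))) })

evalDNF-minterms : (ps : List (Input n)) (x : Input n) →
                   evalDNF (map minterm ps) x ≡ true ⇔ x ∈ ps
evalDNF-minterms ps x = mk⇔
  (λ ev → Any.map (to (satTerm-minterm _ x) ∘ to T-≡)
            (Anyₚ.map⁻ (any⁻ _ _ (from T-≡ ev))))
  (λ mem → to T-≡ (any⁺ _ (Anyₚ.map⁺ (Any.map (λ { refl →
     from T-≡ (from (satTerm-minterm x x) refl) }) mem))))

satTerm-lookup⇒evalDNF : (D : DNF n) (j : Fin (List.length D)) {x : Input n} →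
                         satTerm (List.lookup D j) x ≡ true → evalDNF D x ≡ true
satTerm-lookup⇒evalDNF D j {x} sat =
  to T-≡ (any⁺ (λ t → satTerm t x)
                (Any.map (λ { refl → from T-≡ sat }) (∈-lookup {xs = D} j)))

minterms-uniquelySatisfiable : {ps : List (Input n)} →
                               Unique ps → UniquelySatisfiable (map minterm ps)
minterms-uniquelySatisfiable {ps = q ∷ ps} unique@(_ AllPairs.∷ unique-ps) = satisfiedAlone
  where
  q∉ps : q ∉ ps
  q∉ps = Unique[x∷xs]⇒x∉xs unique
  ∈-ps : ∀ j {x} → satTerm (List.lookup (map minterm ps) j) x ≡ true → x ∈ ps
  ∈-ps j = to (evalDNF-minterms ps _) ∘ satTerm-lookup⇒evalDNF (map minterm ps) j
  satisfiedAlone : UniquelySatisfiable (map minterm (q ∷ ps))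
  satisfiedAlone Fin.zero = q , from (satTerm-minterm q q) refl , λ
    { Fin.zero    0≢0 → contradiction refl 0≢0
    ; (Fin.suc j) _   → ¬-not {y = true} (q∉ps ∘ ∈-ps j) }
  satisfiedAlone (Fin.suc i) =
    let x , sat , others = minterms-uniquelySatisfiable unique-ps i in
    x , sat , λ
    { Fin.zero    _   → ¬-not {y = true} λ sat-q →
        q∉ps (subst (_∈ ps) (to (satTerm-minterm q x) sat-q) (∈-ps i sat))
    ; (Fin.suc j) j≢i → others j (j≢i ∘ cong Fin.suc) }

trueAt? : (g : BoolFun n) → Decidable (λ y → g y ≡ true)
trueAt? g y = g y Bool.≟ true

truePoints : BoolFun n → List (Input n)
truePoints {n} g = filter (trueAt? g) (inputs n)

∈-truePoints : (g : BoolFun n) (x : Input n) → x ∈ truePoints g ⇔ g x ≡ true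
∈-truePoints {n} g x = mk⇔
  (proj₂ ∘ ∈-filter⁻ (trueAt? g) {xs = inputs n})
  (∈-filter⁺ (trueAt? g) (∈-inputs x))

truePoints-unique : (g : BoolFun n) → Unique (truePoints g)
truePoints-unique {n} g = Unique.filter⁺ (trueAt? g) (vectors-unique booleans-unique n)

mintermDNF : BoolFun n → DNF n
mintermDNF g = map minterm (truePoints g)

mintermDNF-represents : (g : BoolFun n) → Represents (mintermDNF g) g
mintermDNF-represents g x with g x in gx
... | true  = from (evalDNF-minterms _ x) (from (∈-truePoints g x) gx)
... | false = ¬-not {y = true} λ ev →
  contradiction (trans (sym gx) (to (∈-truePoints g x) (to (evalDNF-minterms _ x) ev))) λ ()

mintermDNF-uniquelySatisfiable : (g : BoolFun n) → UniquelySatisfiable (mintermDNF g)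
mintermDNF-uniquelySatisfiable g = minterms-uniquelySatisfiable (truePoints-unique g)

lemma1 : ∀ (n : ℕ) (f : BoolFun n) → ∃ λ (f' : BoolFun n) →
    (∃ λ s → IsSens f' s × IsSens f s) ×
    (∃ λ b → IsBS f' b × IsBS f b × IsBSAt f' (zeros n) b) ×
    (∃ λ (D : DNF n) → NormalizedCompactForm f' D)
lemma1 n f =
  let s , sens-f                 = sensitivity f
      b , bs-f@((c , hsb-c) , _) = blockSensitivity f
      f'      = translate f c
      f'0≡0   = translate-zeros f c
      hsb-0   = translate-centre f c hsb-c
      bs-f'   = IsBS-translate f c bs-f
      bs-f'-0 = IsBS⇒IsBSAt bs-f' hsb-0
  in  f' ,
      (s , IsSens-translate f c sens-f , sens-f) ,
      (b , bs-f' , bs-f , bs-f'-0) ,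
      mintermDNF f' ,
      ( mintermDNF-represents f'
      , f'0≡0
      , (b , IsBS⇒IsBS0 bs-f' f'0≡0 hsb-0 , bs-f'-0)
      , mintermDNF-uniquelySatisfiable f')
      , (b , bs-f' , bs-f'-0)
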